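{- Let $n\ge 2$, let $f_m$ denote the $m$-th Fibonacci number ($f_1=f_2=1$, $f_m=f_{m-1}+f_{m-2}$), and let $L_1$ and $U$ be the $n\times n$ matrices defined as follows: $L_1$ is lower bidiagonal with diagonal entries $1$ and subdiagonal entries $(L_1)_{i+1,i}=x_i$ ($1\le i\le n-1$); $U$ is upper bidiagonal with diagonal entries $y_i$ ($1\le i\le n$) and superdiagonal entries $-1$; where $x_1=-1/2$, $y_1=2$, $x_i=-f_{2i-1}/f_{2i+1}$ and $y_i=f_{2i+1}/f_{2i-1}$ for $2\le i\le n-1$, and $y_n=f_{2n}/f_{2n-1}$. Then $U^{ -1}$ is upper triangular with entries \[ (U^{ -1})_{ij}=\frac{f_{2i-1}}{f_{2j+1}}\ (1\le i\le j\le n-1),\qquad (U^{ -1})_{in}=\frac{f_{2i-1}}{f_{2n}}\ (1\le i\le n), \] and $(U^{ -1})_{ij}=0$ for $i>j$; and $L_1^{ -1}$ is lower triangular with diagonal entries $1$, entries $(L_1^{ -1})_{ij}=\dfrac{f_{2j-1}}{f_{2i-1}}$ for $1\le j<i\le n$, and $0$ above the diagonal.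
   Context: These $L_1,U$ are the factors of the $LU$ factorization $L_{P_n}+I_n=L_1U$, where $L_{P_n}$ is the Laplacian matrix of the path on $n$ vertices. -}

module Defs where

open import Data.Nat as ℕ using (ℕ; zero; suc; _∸_)
open import Data.Nat.Properties using (_≟_; _<?_)
open import Data.Fin using (Fin; toℕ)
import Data.Fin as Fin
open import Data.Integer using (+_)
open import Data.Rational using (ℚ; 0ℚ; 1ℚ; _+_; _*_; -_; _/_)
open import Data.Bool using (if_then_else_)
open import Relation.Nullary using (does)

fib : ℕ → ℕ
fib 0 = 0
fib 1 = 1
fib (suc (suc m)) = fib (suc m) ℕ.+ fib m

-- the rational number a / b (all denominators used below are positive
-- Fibonacci numbers; the zero-denominator clause is never reached)
frac : ℕ → ℕ → ℚ
frac a zero = 0ℚ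
frac a (suc b) = (+ a) / suc b

Matrix : ℕ → Set
Matrix n = Fin n → Fin n → ℚ

sumFin : (n : ℕ) → (Fin n → ℚ) → ℚ
sumFin zero g = 0ℚ
sumFin (suc n) g = g Fin.zero + sumFin n (λ k → g (Fin.suc k))


_⊗_ : {n : ℕ} → Matrix n → Matrix n → Matrix n
_⊗_ {n} A B i j = sumFin n (λ k → A i k * B k j)

identity : (n : ℕ) → Matrix n
identity n i j = if does (toℕ i ≟ toℕ j) then 1ℚ else 0ℚ

-- In what follows, indices are 1-based: row/column a : Fin n has
-- index i = toℕ a + 1.

xVal : ℕ → ℚ
xVal i = if does (i ≟ 1) then - frac 1 2
         else - frac (fib (2 ℕ.* i ∸ 1)) (fib (2 ℕ.* i ℕ.+ 1))

yVal : ℕ → ℕ → ℚ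
yVal n i = if does (i ≟ n) then frac (fib (2 ℕ.* n)) (fib (2 ℕ.* n ∸ 1))
           else (if does (i ≟ 1) then frac 2 1
           else frac (fib (2 ℕ.* i ℕ.+ 1)) (fib (2 ℕ.* i ∸ 1)))

L₁ : (n : ℕ) → Matrix n
L₁ n a b = let i = suc (toℕ a) ; j = suc (toℕ b) in
  if does (i ≟ j) then 1ℚ
  else (if does (i ≟ suc j) then xVal j else 0ℚ)

U : (n : ℕ) → Matrix n
U n a b = let i = suc (toℕ a) ; j = suc (toℕ b) in
  if does (i ≟ j) then yVal n i
  else (if does (j ≟ suc i) then - 1ℚ else 0ℚ)

Uinv : (n : ℕ) → Matrix n
Uinv n a b = let i = suc (toℕ a) ; j = suc (toℕ b) in
  if does (j <? i) then 0ℚ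
  else (if does (j ≟ n) then frac (fib (2 ℕ.* i ∸ 1)) (fib (2 ℕ.* n))
        else frac (fib (2 ℕ.* i ∸ 1)) (fib (2 ℕ.* j ℕ.+ 1)))

L₁inv : (n : ℕ) → Matrix n
L₁inv n a b = let i = suc (toℕ a) ; j = suc (toℕ b) in
  if does (i ≟ j) then 1ℚ
  else (if does (j <? i) then frac (fib (2 ℕ.* j ∸ 1)) (fib (2 ℕ.* i ∸ 1))
        else 0ℚ)

{-# OPTIONS --safe #-}
module Submission where

-- Write o i = f (2i-1) and let d j = f (2j+1) = o (j+1) for j < n, d n = f (2n).
-- Then U has diagonal y i = d i / o i, the claimed U⁻¹ has entries o i / d j on and
-- above the diagonal, L₁ has subdiagonal x i = - o i / o (i+1), and the claimed L₁⁻¹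
-- has entries o j / o i on and below the diagonal (for i = 1 these agree with the
-- special values y 1 = 2 and x 1 = -1/2 because f 1 = 1 and f 3 = 2).  A product with
-- a bidiagonal factor has at most two nonzero terms per entry, and these cancel by
-- the telescoping rule (a/b)(b/c) = a/c together with d i = o (i+1).

open import Defs
open import Data.Nat as ℕ using (ℕ; zero; suc; _∸_; _<_; _≤_; z≤n; s≤s)
open import Data.Nat.Properties
  using (_≟_; _<?_; <-cmp; ≤-refl; ≤-trans; <-trans; ≤-<-trans; m≤m+n; m≤n+m; n<1+n;
         m<n⇒m<1+n; m≤n⇒m≤1+n; m≤n⇒m<n∨m≡n; <⇒≤; <⇒≢; >⇒≢; <⇒≯; ≤⇒≯; 1+n≢n;
         suc-injective; *-suc; +-comm)
open import Data.Fin using (Fin; toℕ)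
open import Data.Fin.Properties using (toℕ<n)
open import Data.Integer using (+_)
import Data.Integer.Properties as ℤ
open import Data.Rational using (ℚ; 0ℚ; 1ℚ; _+_; _*_; -_; _-_; toℚᵘ)
open import Data.Rational.Properties
  using (toℚᵘ-injective; toℚᵘ-homo-*; toℚᵘ-fromℚᵘ; neg-distribˡ-*; +-identityˡ;
         +-identityʳ; +-inverseʳ; *-identityˡ; *-identityʳ; *-zeroˡ; *-zeroʳ)
import Data.Rational.Unnormalised as ℚᵘ
import Data.Rational.Unnormalised.Properties as ℚᵘ
open import Data.Rational.Solver using (module +-*-Solver)
open import Data.Bool using (if_then_else_)
open import Data.Bool.Properties using (if-float)
open import Data.Product using (_×_; _,_)
open import Data.Sum using (inj₁; inj₂)
open import Function using (_∘_)
open import Relation.Nullary using (Dec; yes; no; does; ¬_)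
open import Relation.Nullary.Decidable using (dec-true; dec-false)
open import Relation.Binary using (tri<; tri≈; tri>)
open import Relation.Binary.PropositionalEquality
open +-*-Solver using (solve; _:+_; _:*_; _:-_; :-_; con; _:=_)

if-yes : ∀ {P A : Set} {x y : A} (d : Dec P) → P → (if does d then x else y) ≡ x
if-yes {x = x} {y} d p = cong (λ b → if b then x else y) (dec-true d p)

if-no : ∀ {P A : Set} {x y : A} (d : Dec P) → ¬ P → (if does d then x else y) ≡ y
if-no {x = x} {y} d ¬p = cong (λ b → if b then x else y) (dec-false d ¬p)

fib-pos : ∀ {m} → 0 < m → 0 < fib m
fib-pos {1} _ = s≤s z≤n
fib-pos {suc (suc m)} _ = ≤-trans (fib-pos {suc m} (s≤s z≤n)) (m≤m+n (fib (suc m)) (fib m))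

oddFib : ℕ → ℕ
oddFib i = fib (2 ℕ.* i ∸ 1)

oddFib-suc : ∀ i → oddFib (suc i) ≡ fib (2 ℕ.* i ℕ.+ 1)
oddFib-suc i = cong fib (trans (cong (_∸ 1) (*-suc 2 i)) (+-comm 1 (2 ℕ.* i)))

oddFib-pos : ∀ i → 0 < oddFib (suc i)
oddFib-pos i = subst (0 <_) (sym (oddFib-suc i)) (fib-pos (m≤n+m 1 (2 ℕ.* i)))

den : ℕ → ℕ → ℕ
den n j = if does (j ≟ n) then fib (2 ℕ.* n) else fib (2 ℕ.* j ℕ.+ 1)

den-last : ∀ n → den n n ≡ fib (2 ℕ.* n)
den-last n = if-yes (n ≟ n) refl

den-below : ∀ n {j} → j ≢ n → den n j ≡ oddFib (suc j)
den-below n {j} j≢n = trans (if-no (j ≟ n) j≢n) (sym (oddFib-suc j))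

den-pos : ∀ n j → 0 < den n (suc j)
den-pos n j with suc j ≟ n
... | yes refl = subst (0 <_) (sym (den-last (suc j))) (fib-pos {2 ℕ.* suc j} (s≤s z≤n))
... | no 1+j≢n = subst (0 <_) (sym (den-below n 1+j≢n)) (oddFib-pos (suc j))

frac-cancel : ∀ a {b c} → 0 < b → 0 < c → frac a b * frac b c ≡ frac a c
frac-cancel a {suc b} {suc c} _ _ = toℚᵘ-injective (begin
  toℚᵘ (frac a (suc b) * frac (suc b) (suc c))
    ≈⟨ toℚᵘ-homo-* (frac a (suc b)) (frac (suc b) (suc c)) ⟩
  toℚᵘ (frac a (suc b)) ℚᵘ.* toℚᵘ (frac (suc b) (suc c))
    ≈⟨ ℚᵘ.*-cong (toℚᵘ-fromℚᵘ (ℚᵘ.mkℚᵘ (+ a) b)) (toℚᵘ-fromℚᵘ (ℚᵘ.mkℚᵘ (+ suc b) c)) ⟩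
  ℚᵘ.mkℚᵘ (+ a) b ℚᵘ.* ℚᵘ.mkℚᵘ (+ suc b) c
    ≈⟨ ℚᵘ.*≡* (ℤ.*-assoc (+ a) (+ suc b) (+ suc c)) ⟩
  ℚᵘ.mkℚᵘ (+ a) c
    ≈⟨ toℚᵘ-fromℚᵘ (ℚᵘ.mkℚᵘ (+ a) c) ⟨
  toℚᵘ (frac a (suc c)) ∎)
  where open ℚᵘ.≃-Reasoning

frac-self : ∀ {b} → 0 < b → frac b b ≡ 1ℚ
frac-self {suc b} _ = toℚᵘ-injective
  (ℚᵘ.≃-trans (toℚᵘ-fromℚᵘ (ℚᵘ.mkℚᵘ (+ suc b) b)) (ℚᵘ.*≡* (ℤ.*-comm (+ suc b) (+ 1))))

frac-inverse : ∀ {a b} → 0 < a → 0 < b → frac a b * frac b a ≡ 1ℚ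
frac-inverse {a} 0<a 0<b = trans (frac-cancel a 0<b 0<a) (frac-self 0<a)

-1*p≡-p : ∀ p → - 1ℚ * p ≡ - p
-1*p≡-p p = trans (sym (neg-distribˡ-* 1ℚ p)) (cong -_ (*-identityˡ p))

x≡0⇒x*y≡0 : ∀ {x} y → x ≡ 0ℚ → x * y ≡ 0ℚ
x≡0⇒x*y≡0 y refl = *-zeroˡ y

y≡0⇒x*y≡0 : ∀ x {y} → y ≡ 0ℚ → x * y ≡ 0ℚ
y≡0⇒x*y≡0 x refl = *-zeroʳ x

sumℕ : ℕ → (ℕ → ℚ) → ℚ
sumℕ zero g = 0ℚ
sumℕ (suc n) g = g 0 + sumℕ n (g ∘ suc)

sumFin-toℕ : ∀ n (g : ℕ → ℚ) → sumFin n (g ∘ toℕ) ≡ sumℕ n g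
sumFin-toℕ zero g = refl
sumFin-toℕ (suc n) g = cong (_+_ (g 0)) (sumFin-toℕ n (g ∘ suc))

sum-tail : ∀ n (g : ℕ → ℚ) → g 0 ≡ 0ℚ → sumℕ (suc n) g ≡ sumℕ n (g ∘ suc)
sum-tail n g g0≡0 = trans (cong (_+ sumℕ n (g ∘ suc)) g0≡0) (+-identityˡ _)

sum-zero : ∀ n {g : ℕ → ℚ} → (∀ k → g k ≡ 0ℚ) → sumℕ n g ≡ 0ℚ
sum-zero zero g≡0 = refl
sum-zero (suc n) {g} g≡0 = trans (sum-tail n g (g≡0 0)) (sum-zero n (g≡0 ∘ suc))

sum-single : ∀ n {g : ℕ → ℚ} {p} → p ≤ n → (∀ k → k ≢ p → g k ≡ 0ℚ) → g n ≡ 0ℚ →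
             sumℕ n g ≡ g p
sum-single zero {p = zero} _ _ g0≡0 = sym g0≡0
sum-single (suc n) {g} {zero} _ g≡0 _ =
  trans (cong (_+_ (g 0)) (sum-zero n (λ k → g≡0 (suc k) λ ()))) (+-identityʳ (g 0))
sum-single (suc n) {g} {suc p} (s≤s p≤n) g≡0 gn≡0 =
  trans (sum-tail n g (g≡0 0 λ ()))
        (sum-single n p≤n (λ k k≢p → g≡0 (suc k) (k≢p ∘ suc-injective)) gn≡0)

sum-pair : ∀ n {g : ℕ → ℚ} {p} → p < n → (∀ k → k ≢ p → k ≢ suc p → g k ≡ 0ℚ) → g n ≡ 0ℚ →
           sumℕ n g ≡ g p + g (suc p)
sum-pair (suc n) {g} {zero} (s≤s z≤n) g≡0 gn≡0 =
  cong (_+_ (g 0)) (sum-single n z≤n (λ k k≢0 → g≡0 (suc k) (λ ()) (k≢0 ∘ suc-injective)) gn≡0)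
sum-pair (suc n) {g} {suc p} (s≤s p<n) g≡0 gn≡0 =
  trans (sum-tail n g (g≡0 0 (λ ()) (λ ())))
        (sum-pair n p<n (λ k k≢p k≢1+p → g≡0 (suc k) (k≢p ∘ suc-injective) (k≢1+p ∘ suc-injective))
                  gn≡0)

-- The pair {p, p+1} may stick out of 1..n by one index, where h must then vanish.
sum-pair₁ : ∀ n (h : ℕ → ℚ) {p} → p ≤ n → (∀ k → k ≢ p → k ≢ suc p → h k ≡ 0ℚ) →
            h 0 ≡ 0ℚ → h (suc n) ≡ 0ℚ → sumℕ n (h ∘ suc) ≡ h p + h (suc p)
sum-pair₁ n h p≤n h≡0 h0≡0 h[1+n]≡0 =
  trans (sym (sum-tail n h h0≡0)) (sum-pair (suc n) (s≤s p≤n) h≡0 h[1+n]≡0)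

-- Matrices indexed by all of ℕ, read 1-based: row/column a : Fin n is index suc (toℕ a).
-- The entries outside 1..n let boundary rows and columns of bidiagonal products be
-- treated like interior ones.
ℕMatrix : Set
ℕMatrix = ℕ → ℕ → ℚ

restrict : (n : ℕ) → ℕMatrix → Matrix n
restrict n A a b = A (suc (toℕ a)) (suc (toℕ b))

_·⟨_⟩_ : ℕMatrix → ℕ → ℕMatrix → ℕMatrix
(A ·⟨ n ⟩ B) i j = sumℕ n (λ k → A i (suc k) * B (suc k) j)

δ : ℕ → ℕ → ℚ
δ i j = if does (i ≟ j) then 1ℚ else 0ℚ

IsIdentity : ℕ → ℕMatrix → Set
IsIdentity n M = ∀ {i j} → i < n → j < n → M (suc i) (suc j) ≡ δ i j

isIdentity : ∀ {n} M →
  (∀ {i} → i < n → M (suc i) (suc i) ≡ 1ℚ) →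
  (∀ {i j} → j < i → i < n → M (suc i) (suc j) ≡ 0ℚ) →
  (∀ {i j} → i < j → j < n → M (suc i) (suc j) ≡ 0ℚ) →
  IsIdentity n M
isIdentity M diag below above {i} {j} i<n j<n with <-cmp i j
... | tri< i<j i≢j _ = trans (above i<j j<n) (sym (if-no (i ≟ j) i≢j))
... | tri≈ _ refl _ = trans (diag i<n) (sym (if-yes (i ≟ i) refl))
... | tri> _ i≢j j<i = trans (below j<i i<n) (sym (if-no (i ≟ j) i≢j))

restrict-identity : ∀ n A B → IsIdentity n (A ·⟨ n ⟩ B) →
                    ∀ a b → (restrict n A ⊗ restrict n B) a b ≡ identity n a b
restrict-identity n A B AB≡I a b =
  trans (sumFin-toℕ n (λ k → A (suc (toℕ a)) (suc k) * B (suc k) (suc (toℕ b))))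
        (AB≡I (toℕ<n a) (toℕ<n b))

-- Copies of the matrices of Defs with U n = restrict n (Uℕ n) definitionally, and
-- likewise for Uinv, L₁ and L₁inv.
Uℕ : ℕ → ℕMatrix
Uℕ n i j = if does (i ≟ j) then yVal n i else (if does (j ≟ suc i) then - 1ℚ else 0ℚ)

Uinvℕ : ℕ → ℕMatrix
Uinvℕ n i j = if does (j <? i) then 0ℚ
  else (if does (j ≟ n) then frac (oddFib i) (fib (2 ℕ.* n))
        else frac (oddFib i) (fib (2 ℕ.* j ℕ.+ 1)))

L₁ℕ : ℕMatrix
L₁ℕ i j = if does (i ≟ j) then 1ℚ else (if does (i ≟ suc j) then xVal j else 0ℚ)

L₁invℕ : ℕMatrix
L₁invℕ i j = if does (i ≟ j) then 1ℚ
  else (if does (j <? i) then frac (oddFib j) (oddFib i) else 0ℚ)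

U-diag : ∀ n i → Uℕ n i i ≡ yVal n i
U-diag n i = if-yes (i ≟ i) refl

U-super : ∀ n i → Uℕ n i (suc i) ≡ - 1ℚ
U-super n i = trans (if-no (i ≟ suc i) (<⇒≢ (n<1+n i))) (if-yes (suc i ≟ suc i) refl)

U-off : ∀ n {i k} → i ≢ k → k ≢ suc i → Uℕ n i k ≡ 0ℚ
U-off n {i} {k} i≢k k≢1+i = trans (if-no (i ≟ k) i≢k) (if-no (k ≟ suc i) k≢1+i)

yVal-den : ∀ n i → yVal n (suc i) ≡ frac (den n (suc i)) (oddFib (suc i))
yVal-den n i with suc i ≟ n
... | yes refl = trans (if-yes (suc i ≟ suc i) refl)
                       (cong (λ m → frac m (oddFib (suc i))) (sym (den-last (suc i))))
... | no 1+i≢n = trans (if-no (suc i ≟ n) 1+i≢n)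
                 (trans (interior i)
                        (cong (λ m → frac m (oddFib (suc i))) (sym (if-no (suc i ≟ n) 1+i≢n))))
  where
  interior : ∀ i → (if does (suc i ≟ 1) then frac 2 1
                    else frac (fib (2 ℕ.* suc i ℕ.+ 1)) (oddFib (suc i)))
                   ≡ frac (fib (2 ℕ.* suc i ℕ.+ 1)) (oddFib (suc i))
  interior zero = refl
  interior (suc i) = refl

Uinv-lower : ∀ n {i j} → j < i → Uinvℕ n i j ≡ 0ℚ
Uinv-lower n {i} {j} j<i = if-yes (j <? i) j<i

Uinv-upper : ∀ n {i j} → i ≤ j → Uinvℕ n i j ≡ frac (oddFib i) (den n j)
Uinv-upper n {i} {j} i≤j =
  trans (if-no (j <? i) (≤⇒≯ i≤j)) (sym (if-float (frac (oddFib i)) (does (j ≟ n))))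

L₁-diag : ∀ i → L₁ℕ i i ≡ 1ℚ
L₁-diag i = if-yes (i ≟ i) refl

L₁-sub : ∀ j → L₁ℕ (suc j) j ≡ xVal j
L₁-sub j = trans (if-no (suc j ≟ j) 1+n≢n) (if-yes (suc j ≟ suc j) refl)

L₁-off : ∀ {i j} → i ≢ j → i ≢ suc j → L₁ℕ i j ≡ 0ℚ
L₁-off {i} {j} i≢j i≢1+j = trans (if-no (i ≟ j) i≢j) (if-no (i ≟ suc j) i≢1+j)

xVal-oddFib : ∀ i → xVal (suc i) ≡ - frac (oddFib (suc i)) (oddFib (suc (suc i)))
xVal-oddFib zero = refl
xVal-oddFib (suc i) = cong (λ m → - frac (oddFib (suc (suc i))) m) (sym (oddFib-suc (suc (suc i))))

L₁inv-diag : ∀ i → L₁invℕ i i ≡ 1ℚ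
L₁inv-diag i = if-yes (i ≟ i) refl

L₁inv-upper : ∀ {i j} → i < j → L₁invℕ i j ≡ 0ℚ
L₁inv-upper {i} {j} i<j = trans (if-no (i ≟ j) (<⇒≢ i<j)) (if-no (j <? i) (<⇒≯ i<j))

L₁inv-lower : ∀ {i j} → j ≤ i → L₁invℕ (suc i) (suc j) ≡ frac (oddFib (suc j)) (oddFib (suc i))
L₁inv-lower {i} {j} j≤i with m≤n⇒m<n∨m≡n j≤i
... | inj₁ j<i = trans (if-no (suc i ≟ suc j) (>⇒≢ (s≤s j<i))) (if-yes (suc j <? suc i) (s≤s j<i))
... | inj₂ refl = trans (L₁inv-diag (suc i)) (sym (frac-self (oddFib-pos i)))

U-mul : ∀ n (B : ℕMatrix) {i} j → i < n → B (suc n) j ≡ 0ℚ →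
        (Uℕ n ·⟨ n ⟩ B) (suc i) j ≡ yVal n (suc i) * B (suc i) j - B (suc (suc i)) j
U-mul n B {i} j i<n B[1+n]≡0 = begin
  (Uℕ n ·⟨ n ⟩ B) (suc i) j
    ≡⟨ sum-pair₁ n (λ k → Uℕ n (suc i) k * B k j) i<n off (off 0 (λ ()) (λ ()))
                 (y≡0⇒x*y≡0 (Uℕ n (suc i) (suc n)) B[1+n]≡0) ⟩
  Uℕ n (suc i) (suc i) * B (suc i) j + Uℕ n (suc i) (suc (suc i)) * B (suc (suc i)) j
    ≡⟨ cong₂ (λ y m → y * B (suc i) j + m * B (suc (suc i)) j)
             (U-diag n (suc i)) (U-super n (suc i)) ⟩
  yVal n (suc i) * B (suc i) j + - 1ℚ * B (suc (suc i)) j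
    ≡⟨ cong (_+_ (yVal n (suc i) * B (suc i) j)) (-1*p≡-p (B (suc (suc i)) j)) ⟩
  yVal n (suc i) * B (suc i) j - B (suc (suc i)) j ∎
  where
  open ≡-Reasoning
  off : ∀ k → k ≢ suc i → k ≢ suc (suc i) → Uℕ n (suc i) k * B k j ≡ 0ℚ
  off k k≢1+i k≢2+i = x≡0⇒x*y≡0 (B k j) (U-off n (≢-sym k≢1+i) k≢2+i)

mul-U : ∀ n (B : ℕMatrix) i {j} → j < n → B i 0 ≡ 0ℚ →
        (B ·⟨ n ⟩ Uℕ n) i (suc j) ≡ B i (suc j) * yVal n (suc j) - B i j
mul-U n B i {j} j<n Bi0≡0 = begin
  (B ·⟨ n ⟩ Uℕ n) i (suc j)
    ≡⟨ sum-pair₁ n (λ k → B i k * Uℕ n k (suc j)) (<⇒≤ j<n) off (x≡0⇒x*y≡0 (Uℕ n 0 (suc j)) Bi0≡0)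
                 (off (suc n) (>⇒≢ (m<n⇒m<1+n j<n)) (>⇒≢ (s≤s j<n))) ⟩
  B i j * Uℕ n j (suc j) + B i (suc j) * Uℕ n (suc j) (suc j)
    ≡⟨ cong₂ (λ m y → B i j * m + B i (suc j) * y) (U-super n j) (U-diag n (suc j)) ⟩
  B i j * - 1ℚ + B i (suc j) * yVal n (suc j)
    ≡⟨ solve 3 (λ b b′ y → b :* con (- 1ℚ) :+ b′ :* y := b′ :* y :- b) refl
             (B i j) (B i (suc j)) (yVal n (suc j)) ⟩
  B i (suc j) * yVal n (suc j) - B i j ∎
  where
  open ≡-Reasoning
  off : ∀ k → k ≢ j → k ≢ suc j → B i k * Uℕ n k (suc j) ≡ 0ℚ
  off k k≢j k≢1+j = y≡0⇒x*y≡0 (B i k) (U-off n k≢1+j (≢-sym k≢j ∘ suc-injective))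

L₁-mul : ∀ n (B : ℕMatrix) {i} j → i < n → B 0 j ≡ 0ℚ →
         (L₁ℕ ·⟨ n ⟩ B) (suc i) j ≡ xVal i * B i j + B (suc i) j
L₁-mul n B {i} j i<n B0j≡0 = begin
  (L₁ℕ ·⟨ n ⟩ B) (suc i) j
    ≡⟨ sum-pair₁ n (λ k → L₁ℕ (suc i) k * B k j) (<⇒≤ i<n) off (y≡0⇒x*y≡0 (L₁ℕ (suc i) 0) B0j≡0)
                 (off (suc n) (>⇒≢ (m<n⇒m<1+n i<n)) (>⇒≢ (s≤s i<n))) ⟩
  L₁ℕ (suc i) i * B i j + L₁ℕ (suc i) (suc i) * B (suc i) j
    ≡⟨ cong₂ (λ x m → x * B i j + m * B (suc i) j) (L₁-sub i) (L₁-diag (suc i)) ⟩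
  xVal i * B i j + 1ℚ * B (suc i) j
    ≡⟨ cong (_+_ (xVal i * B i j)) (*-identityˡ (B (suc i) j)) ⟩
  xVal i * B i j + B (suc i) j ∎
  where
  open ≡-Reasoning
  off : ∀ k → k ≢ i → k ≢ suc i → L₁ℕ (suc i) k * B k j ≡ 0ℚ
  off k k≢i k≢1+i = x≡0⇒x*y≡0 (B k j) (L₁-off (≢-sym k≢1+i) (≢-sym k≢i ∘ suc-injective))

mul-L₁ : ∀ n (B : ℕMatrix) i {j} → j < n → B i (suc n) ≡ 0ℚ →
         (B ·⟨ n ⟩ L₁ℕ) i (suc j) ≡ B i (suc j) + B i (suc (suc j)) * xVal (suc j)
mul-L₁ n B i {j} j<n Bi[1+n]≡0 = begin
  (B ·⟨ n ⟩ L₁ℕ) i (suc j)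
    ≡⟨ sum-pair₁ n (λ k → B i k * L₁ℕ k (suc j)) j<n off (off 0 (λ ()) (λ ()))
                 (x≡0⇒x*y≡0 (L₁ℕ (suc n) (suc j)) Bi[1+n]≡0) ⟩
  B i (suc j) * L₁ℕ (suc j) (suc j) + B i (suc (suc j)) * L₁ℕ (suc (suc j)) (suc j)
    ≡⟨ cong₂ (λ m x → B i (suc j) * m + B i (suc (suc j)) * x) (L₁-diag (suc j)) (L₁-sub (suc j)) ⟩
  B i (suc j) * 1ℚ + B i (suc (suc j)) * xVal (suc j)
    ≡⟨ cong (_+ B i (suc (suc j)) * xVal (suc j)) (*-identityʳ (B i (suc j))) ⟩
  B i (suc j) + B i (suc (suc j)) * xVal (suc j) ∎
  where
  open ≡-Reasoning
  off : ∀ k → k ≢ suc j → k ≢ suc (suc j) → B i k * L₁ℕ k (suc j) ≡ 0ℚ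
  off k k≢1+j k≢2+j = y≡0⇒x*y≡0 (B i k) (L₁-off k≢1+j k≢2+j)

U·Uinv : ∀ n → IsIdentity n (Uℕ n ·⟨ n ⟩ Uinvℕ n)
U·Uinv n = isIdentity (Uℕ n ·⟨ n ⟩ Uinvℕ n) diag below above
  where
  open ≡-Reasoning

  product : ∀ {i} j → i < n → j < n → (Uℕ n ·⟨ n ⟩ Uinvℕ n) (suc i) (suc j)
            ≡ yVal n (suc i) * Uinvℕ n (suc i) (suc j) - Uinvℕ n (suc (suc i)) (suc j)
  product j i<n j<n = U-mul n (Uinvℕ n) (suc j) i<n (Uinv-lower n (s≤s j<n))

  diag : ∀ {i} → i < n → (Uℕ n ·⟨ n ⟩ Uinvℕ n) (suc i) (suc i) ≡ 1ℚ
  diag {i} i<n = begin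
    (Uℕ n ·⟨ n ⟩ Uinvℕ n) (suc i) (suc i)
      ≡⟨ product i i<n i<n ⟩
    yVal n (suc i) * Uinvℕ n (suc i) (suc i) - Uinvℕ n (suc (suc i)) (suc i)
      ≡⟨ cong₂ _-_ (cong₂ _*_ (yVal-den n i) (Uinv-upper n {suc i} ≤-refl))
                   (Uinv-lower n (n<1+n (suc i))) ⟩
    frac (den n (suc i)) (oddFib (suc i)) * frac (oddFib (suc i)) (den n (suc i)) - 0ℚ
      ≡⟨ cong (_- 0ℚ) (frac-inverse (den-pos n i) (oddFib-pos i)) ⟩
    1ℚ - 0ℚ
      ≡⟨⟩
    1ℚ ∎

  below : ∀ {i j} → j < i → i < n → (Uℕ n ·⟨ n ⟩ Uinvℕ n) (suc i) (suc j) ≡ 0ℚ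
  below {i} {j} j<i i<n = begin
    (Uℕ n ·⟨ n ⟩ Uinvℕ n) (suc i) (suc j)
      ≡⟨ product j i<n (<-trans j<i i<n) ⟩
    yVal n (suc i) * Uinvℕ n (suc i) (suc j) - Uinvℕ n (suc (suc i)) (suc j)
      ≡⟨ cong₂ _-_ (cong (yVal n (suc i) *_) (Uinv-lower n (s≤s j<i)))
                   (Uinv-lower n (s≤s (m<n⇒m<1+n j<i))) ⟩
    yVal n (suc i) * 0ℚ - 0ℚ
      ≡⟨ cong (_- 0ℚ) (*-zeroʳ (yVal n (suc i))) ⟩
    0ℚ - 0ℚ
      ≡⟨⟩
    0ℚ ∎

  above : ∀ {i j} → i < j → j < n → (Uℕ n ·⟨ n ⟩ Uinvℕ n) (suc i) (suc j) ≡ 0ℚ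
  above {i} {j} i<j j<n = begin
    (Uℕ n ·⟨ n ⟩ Uinvℕ n) (suc i) (suc j)
      ≡⟨ product j (<-trans i<j j<n) j<n ⟩
    yVal n (suc i) * Uinvℕ n (suc i) (suc j) - Uinvℕ n (suc (suc i)) (suc j)
      ≡⟨ cong₂ _-_ (cong₂ _*_ y≡a (Uinv-upper n (<⇒≤ (s≤s i<j)))) (Uinv-upper n (s≤s i<j)) ⟩
    a * b - c
      ≡⟨ cong (_- c) (frac-cancel (oddFib (suc (suc i))) (oddFib-pos i) (den-pos n j)) ⟩
    c - c
      ≡⟨ +-inverseʳ c ⟩
    0ℚ ∎
    where
    a b c : ℚ
    a = frac (oddFib (suc (suc i))) (oddFib (suc i))
    b = frac (oddFib (suc i)) (den n (suc j))
    c = frac (oddFib (suc (suc i))) (den n (suc j))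
    y≡a : yVal n (suc i) ≡ a
    y≡a = trans (yVal-den n i)
                (cong (λ m → frac m (oddFib (suc i))) (den-below n (<⇒≢ (≤-<-trans i<j j<n))))

Uinv·U : ∀ n → IsIdentity n (Uinvℕ n ·⟨ n ⟩ Uℕ n)
Uinv·U n = isIdentity (Uinvℕ n ·⟨ n ⟩ Uℕ n) diag below above
  where
  open ≡-Reasoning

  product : ∀ i {j} → j < n → (Uinvℕ n ·⟨ n ⟩ Uℕ n) (suc i) (suc j)
            ≡ Uinvℕ n (suc i) (suc j) * yVal n (suc j) - Uinvℕ n (suc i) j
  product i j<n = mul-U n (Uinvℕ n) (suc i) j<n (Uinv-lower n {suc i} (s≤s z≤n))

  diag : ∀ {i} → i < n → (Uinvℕ n ·⟨ n ⟩ Uℕ n) (suc i) (suc i) ≡ 1ℚ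
  diag {i} i<n = begin
    (Uinvℕ n ·⟨ n ⟩ Uℕ n) (suc i) (suc i)
      ≡⟨ product i i<n ⟩
    Uinvℕ n (suc i) (suc i) * yVal n (suc i) - Uinvℕ n (suc i) i
      ≡⟨ cong₂ _-_ (cong₂ _*_ (Uinv-upper n {suc i} ≤-refl) (yVal-den n i))
                   (Uinv-lower n (n<1+n i)) ⟩
    frac (oddFib (suc i)) (den n (suc i)) * frac (den n (suc i)) (oddFib (suc i)) - 0ℚ
      ≡⟨ cong (_- 0ℚ) (frac-inverse (oddFib-pos i) (den-pos n i)) ⟩
    1ℚ - 0ℚ
      ≡⟨⟩
    1ℚ ∎

  below : ∀ {i j} → j < i → i < n → (Uinvℕ n ·⟨ n ⟩ Uℕ n) (suc i) (suc j) ≡ 0ℚ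
  below {i} {j} j<i i<n = begin
    (Uinvℕ n ·⟨ n ⟩ Uℕ n) (suc i) (suc j)
      ≡⟨ product i (<-trans j<i i<n) ⟩
    Uinvℕ n (suc i) (suc j) * yVal n (suc j) - Uinvℕ n (suc i) j
      ≡⟨ cong₂ _-_ (cong (_* yVal n (suc j)) (Uinv-lower n (s≤s j<i)))
                   (Uinv-lower n (m<n⇒m<1+n j<i)) ⟩
    0ℚ * yVal n (suc j) - 0ℚ
      ≡⟨ cong (_- 0ℚ) (*-zeroˡ (yVal n (suc j))) ⟩
    0ℚ - 0ℚ
      ≡⟨⟩
    0ℚ ∎

  above : ∀ {i j} → i < j → j < n → (Uinvℕ n ·⟨ n ⟩ Uℕ n) (suc i) (suc j) ≡ 0ℚ
  above {i} {suc j} (s≤s i≤j) 1+j<n = begin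
    (Uinvℕ n ·⟨ n ⟩ Uℕ n) (suc i) (suc (suc j))
      ≡⟨ product i 1+j<n ⟩
    Uinvℕ n (suc i) (suc (suc j)) * yVal n (suc (suc j)) - Uinvℕ n (suc i) (suc j)
      ≡⟨ cong₂ _-_ (cong₂ _*_ (Uinv-upper n (s≤s (m≤n⇒m≤1+n i≤j))) (yVal-den n (suc j))) u≡c ⟩
    a * b - c
      ≡⟨ cong (_- c) (frac-cancel (oddFib (suc i)) (den-pos n (suc j)) (oddFib-pos (suc j))) ⟩
    c - c
      ≡⟨ +-inverseʳ c ⟩
    0ℚ ∎
    where
    a b c : ℚ
    a = frac (oddFib (suc i)) (den n (suc (suc j)))
    b = frac (den n (suc (suc j))) (oddFib (suc (suc j)))
    c = frac (oddFib (suc i)) (oddFib (suc (suc j)))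
    u≡c : Uinvℕ n (suc i) (suc j) ≡ c
    u≡c = trans (Uinv-upper n (s≤s i≤j)) (cong (frac (oddFib (suc i))) (den-below n (<⇒≢ 1+j<n)))

L₁·L₁inv : ∀ n → IsIdentity n (L₁ℕ ·⟨ n ⟩ L₁invℕ)
L₁·L₁inv n = isIdentity (L₁ℕ ·⟨ n ⟩ L₁invℕ) diag below above
  where
  open ≡-Reasoning

  product : ∀ {i} j → i < n → (L₁ℕ ·⟨ n ⟩ L₁invℕ) (suc i) (suc j)
            ≡ xVal i * L₁invℕ i (suc j) + L₁invℕ (suc i) (suc j)
  product j i<n = L₁-mul n L₁invℕ (suc j) i<n (L₁inv-upper {j = suc j} (s≤s z≤n))

  diag : ∀ {i} → i < n → (L₁ℕ ·⟨ n ⟩ L₁invℕ) (suc i) (suc i) ≡ 1ℚ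
  diag {i} i<n = begin
    (L₁ℕ ·⟨ n ⟩ L₁invℕ) (suc i) (suc i)
      ≡⟨ product i i<n ⟩
    xVal i * L₁invℕ i (suc i) + L₁invℕ (suc i) (suc i)
      ≡⟨ cong₂ _+_ (cong (xVal i *_) (L₁inv-upper (n<1+n i))) (L₁inv-diag (suc i)) ⟩
    xVal i * 0ℚ + 1ℚ
      ≡⟨ cong (_+ 1ℚ) (*-zeroʳ (xVal i)) ⟩
    0ℚ + 1ℚ
      ≡⟨⟩
    1ℚ ∎

  below : ∀ {i j} → j < i → i < n → (L₁ℕ ·⟨ n ⟩ L₁invℕ) (suc i) (suc j) ≡ 0ℚ
  below {suc i} {j} (s≤s j≤i) 1+i<n = begin
    (L₁ℕ ·⟨ n ⟩ L₁invℕ) (suc (suc i)) (suc j)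
      ≡⟨ product j 1+i<n ⟩
    xVal (suc i) * L₁invℕ (suc i) (suc j) + L₁invℕ (suc (suc i)) (suc j)
      ≡⟨ cong₂ _+_ (cong₂ _*_ (xVal-oddFib i) (L₁inv-lower j≤i)) (L₁inv-lower (m≤n⇒m≤1+n j≤i)) ⟩
    - a * b + c
      ≡⟨ solve 3 (λ a b c → (:- a) :* b :+ c := c :- b :* a) refl a b c ⟩
    c - b * a
      ≡⟨ cong (_-_ c) (frac-cancel (oddFib (suc j)) (oddFib-pos i) (oddFib-pos (suc i))) ⟩
    c - c
      ≡⟨ +-inverseʳ c ⟩
    0ℚ ∎
    where
    a b c : ℚ
    a = frac (oddFib (suc i)) (oddFib (suc (suc i)))
    b = frac (oddFib (suc j)) (oddFib (suc i))
    c = frac (oddFib (suc j)) (oddFib (suc (suc i)))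

  above : ∀ {i j} → i < j → j < n → (L₁ℕ ·⟨ n ⟩ L₁invℕ) (suc i) (suc j) ≡ 0ℚ
  above {i} {j} i<j j<n = begin
    (L₁ℕ ·⟨ n ⟩ L₁invℕ) (suc i) (suc j)
      ≡⟨ product j (<-trans i<j j<n) ⟩
    xVal i * L₁invℕ i (suc j) + L₁invℕ (suc i) (suc j)
      ≡⟨ cong₂ _+_ (cong (xVal i *_) (L₁inv-upper (m<n⇒m<1+n i<j))) (L₁inv-upper (s≤s i<j)) ⟩
    xVal i * 0ℚ + 0ℚ
      ≡⟨ cong (_+ 0ℚ) (*-zeroʳ (xVal i)) ⟩
    0ℚ + 0ℚ
      ≡⟨⟩
    0ℚ ∎

L₁inv·L₁ : ∀ n → IsIdentity n (L₁invℕ ·⟨ n ⟩ L₁ℕ)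
L₁inv·L₁ n = isIdentity (L₁invℕ ·⟨ n ⟩ L₁ℕ) diag below above
  where
  open ≡-Reasoning

  product : ∀ i {j} → i < n → j < n → (L₁invℕ ·⟨ n ⟩ L₁ℕ) (suc i) (suc j)
            ≡ L₁invℕ (suc i) (suc j) + L₁invℕ (suc i) (suc (suc j)) * xVal (suc j)
  product i i<n j<n = mul-L₁ n L₁invℕ (suc i) j<n (L₁inv-upper (s≤s i<n))

  diag : ∀ {i} → i < n → (L₁invℕ ·⟨ n ⟩ L₁ℕ) (suc i) (suc i) ≡ 1ℚ
  diag {i} i<n = begin
    (L₁invℕ ·⟨ n ⟩ L₁ℕ) (suc i) (suc i)
      ≡⟨ product i i<n i<n ⟩
    L₁invℕ (suc i) (suc i) + L₁invℕ (suc i) (suc (suc i)) * xVal (suc i)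
      ≡⟨ cong₂ _+_ (L₁inv-diag (suc i)) (cong (_* xVal (suc i)) (L₁inv-upper (n<1+n (suc i)))) ⟩
    1ℚ + 0ℚ * xVal (suc i)
      ≡⟨ cong (_+_ 1ℚ) (*-zeroˡ (xVal (suc i))) ⟩
    1ℚ + 0ℚ
      ≡⟨⟩
    1ℚ ∎

  below : ∀ {i j} → j < i → i < n → (L₁invℕ ·⟨ n ⟩ L₁ℕ) (suc i) (suc j) ≡ 0ℚ
  below {i} {j} j<i i<n = begin
    (L₁invℕ ·⟨ n ⟩ L₁ℕ) (suc i) (suc j)
      ≡⟨ product i i<n (<-trans j<i i<n) ⟩
    L₁invℕ (suc i) (suc j) + L₁invℕ (suc i) (suc (suc j)) * xVal (suc j)
      ≡⟨ cong₂ _+_ (L₁inv-lower (<⇒≤ j<i)) (cong₂ _*_ (L₁inv-lower j<i) (xVal-oddFib j)) ⟩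
    a + b * - c
      ≡⟨ solve 3 (λ a b c → a :+ b :* (:- c) := a :- c :* b) refl a b c ⟩
    a - c * b
      ≡⟨ cong (_-_ a) (frac-cancel (oddFib (suc j)) (oddFib-pos (suc j)) (oddFib-pos i)) ⟩
    a - a
      ≡⟨ +-inverseʳ a ⟩
    0ℚ ∎
    where
    a b c : ℚ
    a = frac (oddFib (suc j)) (oddFib (suc i))
    b = frac (oddFib (suc (suc j))) (oddFib (suc i))
    c = frac (oddFib (suc j)) (oddFib (suc (suc j)))

  above : ∀ {i j} → i < j → j < n → (L₁invℕ ·⟨ n ⟩ L₁ℕ) (suc i) (suc j) ≡ 0ℚ
  above {i} {j} i<j j<n = begin
    (L₁invℕ ·⟨ n ⟩ L₁ℕ) (suc i) (suc j)
      ≡⟨ product i (<-trans i<j j<n) j<n ⟩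
    L₁invℕ (suc i) (suc j) + L₁invℕ (suc i) (suc (suc j)) * xVal (suc j)
      ≡⟨ cong₂ _+_ (L₁inv-upper (s≤s i<j))
                   (cong (_* xVal (suc j)) (L₁inv-upper (s≤s (m<n⇒m<1+n i<j)))) ⟩
    0ℚ + 0ℚ * xVal (suc j)
      ≡⟨ cong (_+_ 0ℚ) (*-zeroˡ (xVal (suc j))) ⟩
    0ℚ + 0ℚ
      ≡⟨⟩
    0ℚ ∎

proposition2p6 : (n : ℕ) → 2 ≤ n →
    ((∀ (i j : Fin n) → (U n ⊗ Uinv n) i j ≡ identity n i j) ×
     (∀ (i j : Fin n) → (Uinv n ⊗ U n) i j ≡ identity n i j)) ×
    ((∀ (i j : Fin n) → (L₁ n ⊗ L₁inv n) i j ≡ identity n i j) ×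
     (∀ (i j : Fin n) → (L₁inv n ⊗ L₁ n) i j ≡ identity n i j))
proposition2p6 n _ =
  (restrict-identity n (Uℕ n) (Uinvℕ n) (U·Uinv n) ,
   restrict-identity n (Uinvℕ n) (Uℕ n) (Uinv·U n)) ,
  (restrict-identity n L₁ℕ L₁invℕ (L₁·L₁inv n) ,
   restrict-identity n L₁invℕ L₁ℕ (L₁inv·L₁ n))
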